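{- Let $n\ge 2$, let $k$ be an integer with $2\le k\le n+1$ and set $N=2n-k+1$. Let $P_1,\dots,P_k\in\mathbb{Z}[X]_{\le n}$ be linearly independent over $\mathbb{R}$ with $P_1$ and $P_2$ coprime. Then for each $j=2,\dots,k$, \[ \dim V_N(P_1,\dots,P_j)\ge 2(n-k+1)+j. \] In particular $V_N(P_1,\dots,P_k)=\mathbb{R}[X]_{\le N}$.
   Context: For an integer $N\ge n$ and a subset $\mathcal{A}\subset\mathbb{R}[X]_{\le n}$ containing a nonzero element, let $\mathcal{B}_N(\mathcal{A})=\{Q,XQ,\dots,X^{N-\deg Q}Q:\ Q\in\mathcal{A}\setminus\{0\}\}\subset\mathbb{R}[X]_{\le N}$ and let $V_N(\mathcal{A})$ be the real vector space spanned by $\mathcal{B}_N(\mathcal{A})$; $V_N(P_1,\dots,P_j)$ means $V_N(\{P_1,\dots,P_j\})$.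
   Formalization: The scalar field ℝ is replaced by ℚ: linear independence, coprimality, the span $V_N$ and dimensions are taken over ℚ, and the polynomials of degree at most N are rational. -}

module Defs where

open import Data.Nat using (ℕ; zero; suc; _≤_; _<_; _∸_)
open import Data.Integer using (ℤ)
open import Data.Rational using (ℚ; 0ℚ; _+_; _*_; _/_)
open import Data.Fin using (Fin; toℕ) renaming (zero to fzero; suc to fsuc)
open import Data.List using (List; []; _∷_)
open import Data.List.Relation.Unary.All using (All)
open import Data.Product using (Σ; _×_; _,_; proj₂)
open import Relation.Binary.PropositionalEquality using (_≡_; _≢_)

-- Polynomials with rational coefficients, given by their coefficient
-- sequence (coefficient of X^i at i); genuine polynomials are those with
-- bounded support (see IsPoly).
Poly : Set
Poly = ℕ → ℚ

DegLe : Poly → ℕ → Set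
DegLe p d = ∀ i → d < i → p i ≡ 0ℚ

IsPoly : Poly → Set
IsPoly p = Σ ℕ (DegLe p)

IsDeg : Poly → ℕ → Set
IsDeg p d = (p d ≢ 0ℚ) × DegLe p d

shift : ℕ → Poly → Poly
shift zero p i = p i
shift (suc s) p zero = 0ℚ
shift (suc s) p (suc i) = shift s p i

sumUpTo : ℕ → (ℕ → ℚ) → ℚ
sumUpTo zero f = f 0
sumUpTo (suc m) f = sumUpTo m f + f (suc m)

sumFin : ∀ {m} → (Fin m → ℚ) → ℚ
sumFin {zero} f = 0ℚ
sumFin {suc m} f = f fzero + sumFin (λ t → f (fsuc t))

mul : Poly → Poly → Poly
mul D Q m = sumUpTo m (λ i → D i * Q (m ∸ i))

Divides : Poly → Poly → Set
Divides D P = Σ Poly λ Q → IsPoly Q × (∀ i → mul D Q i ≡ P i)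

Coprime : Poly → Poly → Set
Coprime P Q = ∀ D → IsPoly D → Divides D P → Divides D Q → DegLe D 0

-- integer coefficient vector (a_0,…,a_{n-1}) viewed as a rational polynomial
toPoly : ∀ {n} → (Fin n → ℤ) → Poly
toPoly {zero} a i = 0ℚ
toPoly {suc n} a zero = a fzero / 1
toPoly {suc n} a (suc i) = toPoly (λ t → a (fsuc t)) i

-- B_N(A) = { X^s Q : Q ∈ A, Q ≠ 0, 0 ≤ s ≤ N - deg Q }  (equality pointwise)
B : ℕ → (Poly → Set) → Poly → Set
B N A w = Σ Poly λ Q → A Q × Σ ℕ λ d → IsDeg Q d × Σ ℕ λ s →
  (s ≤ N ∸ d) × (∀ i → w i ≡ shift s Q i)

lincomb : List (ℚ × Poly) → Poly
lincomb [] i = 0ℚ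
lincomb ((c , w) ∷ L) i = c * w i + lincomb L i

InSpan : (Poly → Set) → Poly → Set
InSpan S v = Σ (List (ℚ × Poly)) λ L →
  All (λ cw → S (proj₂ cw)) L × (∀ i → v i ≡ lincomb L i)

V : ℕ → (Poly → Set) → Poly → Set
V N A = InSpan (B N A)

LinIndep : ∀ {m} → (Fin m → Poly) → Set
LinIndep {m} u = ∀ (c : Fin m → ℚ) →
  (∀ i → sumFin (λ t → c t * u t i) ≡ 0ℚ) → ∀ t → c t ≡ 0ℚ

DimGe : (Poly → Set) → ℕ → Set
DimGe W m = Σ (Fin m → Poly) λ u → (∀ t → W (u t)) × LinIndep u

-- the set {P_1, …, P_j} (first j members of the family P)
Gen : ∀ {k n} → (Fin k → Fin n → ℤ) → ℕ → Poly → Set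
Gen {k} P j Q = Σ (Fin k) λ i → (toℕ i < j) × (∀ t → Q t ≡ toPoly (P i) t)

{-# OPTIONS --safe #-}
-- Write W_M = V_M(P_1, …, P_j) and D_M for the set of degrees of its nonzero elements, so that
-- dim W_M = |D_M|. For M ≥ n we have W_M ⊆ W_{M+1} and X·W_M ⊆ W_{M+1}, so D_{M+1} contains D_M
-- and D_M + 1, and M ∈ D_M. Hence D_{M+1} gains at least two new degrees, unless D_M = [b, M] and
-- D_{M+1} has nothing below b. In that case every element of W_{M+1} of degree ≤ M reduces into
-- W_M, so W_M is closed under X within degree ≤ M and equals g·ℚ[X]_{≤M−b} for its element g of
-- degree b; then g divides the coprime P_1 and P_2, so b = 0 and W_M = ℚ[X]_{≤M}. Starting from
-- dim W_n ≥ j this gives dim W_M ≥ min(j + 2(M − n), M + 1); for M = N we have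
-- j + 2(N − n) ≤ N + 1, with equality when j = k, which is the claim.
-- Degree sets are handled constructively through echelon tables: at most one vector of each
-- exact degree, built by Gaussian elimination.
module Submission where

open import Defs
open import Data.Nat using (ℕ; zero; suc; _≤_; _<_; _+_; _*_; _∸_; z≤n; s≤s)
import Data.Nat.Properties as ℕ
open import Data.Rational using (ℚ; 0ℚ; 1ℚ)
import Data.Rational as ℚ
import Data.Rational.Properties as ℚ
open import Data.Rational.Solver using (module +-*-Solver)
open +-*-Solver using (solve; _:=_; _:+_; _:*_; :-_; con)
open import Data.Fin using (Fin; toℕ; inject≤; fromℕ<) renaming (zero to fzero; suc to fsuc)
import Data.Fin.Properties as Fin
open import Data.Vec.Functional using (tail) renaming (_∷_ to _◃_)
open import Data.List using (List; []; _∷_; _++_; map)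
open import Data.List.Relation.Unary.All using (All; []; _∷_)
open import Data.List.Relation.Unary.All.Properties using (++⁺; map⁺)
open import Data.Product using (Σ; ∃; _×_; _,_; proj₁; proj₂)
open import Data.Sum as Sum using (_⊎_; inj₁; inj₂; [_,_]′)
open import Relation.Binary.Definitions using (tri<; tri≈; tri>)
open import Data.Empty using (⊥; ⊥-elim)
open import Data.Unit using (⊤)
open import Data.Integer using (ℤ)
open import Relation.Nullary using (¬_; yes; no; ¬?; _×-dec_)
open import Level using (0ℓ)
open import Relation.Unary using (Pred; Decidable)
open import Relation.Binary.PropositionalEquality

p*q≡0⇒p≡0 : ∀ p q → q ≢ 0ℚ → p ℚ.* q ≡ 0ℚ → p ≡ 0ℚ
p*q≡0⇒p≡0 p q q≢0 pq≡0 = begin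
  p                     ≡⟨ sym (ℚ.*-identityʳ p) ⟩
  p ℚ.* 1ℚ              ≡⟨ cong (p ℚ.*_) (sym (ℚ.*-inverseʳ q)) ⟩
  p ℚ.* (q ℚ.* q⁻¹)     ≡⟨ sym (ℚ.*-assoc p q q⁻¹) ⟩
  (p ℚ.* q) ℚ.* q⁻¹     ≡⟨ cong (ℚ._* q⁻¹) pq≡0 ⟩
  0ℚ ℚ.* q⁻¹            ≡⟨ ℚ.*-zeroˡ q⁻¹ ⟩
  0ℚ                    ∎
  where
  open ≡-Reasoning
  instance _ = ℚ.≢-nonZero q≢0
  q⁻¹ = ℚ.1/ q

infix 4 _≐_
infixl 6 _⊕_
infixl 7 _⊙_

_≐_ : Poly → Poly → Set
p ≐ q = ∀ i → p i ≡ q i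

0ₚ : Poly
0ₚ _ = 0ℚ

_⊕_ : Poly → Poly → Poly
(p ⊕ q) i = p i ℚ.+ q i

_⊙_ : ℚ → Poly → Poly
(c ⊙ p) i = c ℚ.* p i

record IsSubspace (W : Pred Poly 0ℓ) : Set where
  field
    resp-≐ : ∀ {p q} → p ≐ q → W p → W q
    0ₚ∈ : W 0ₚ
    ⊕-closed : ∀ {p q} → W p → W q → W (p ⊕ q)
    ⊙-closed : ∀ c {p} → W p → W (c ⊙ p)

  axpy-closed : ∀ {p q} c → W p → W q → W (p ⊕ c ⊙ q)
  axpy-closed c p∈ q∈ = ⊕-closed p∈ (⊙-closed c q∈)

open IsSubspace

lincomb-++ : ∀ L L′ i → lincomb (L ++ L′) i ≡ lincomb L i ℚ.+ lincomb L′ i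
lincomb-++ [] L′ i = sym (ℚ.+-identityˡ (lincomb L′ i))
lincomb-++ ((c , w) ∷ L) L′ i = trans (cong (c ℚ.* w i ℚ.+_) (lincomb-++ L L′ i))
  (sym (ℚ.+-assoc (c ℚ.* w i) _ _))

scaleCoeffs : ℚ → List (ℚ × Poly) → List (ℚ × Poly)
scaleCoeffs a = map (λ (c , w) → a ℚ.* c , w)

lincomb-scale : ∀ a L i → lincomb (scaleCoeffs a L) i ≡ a ℚ.* lincomb L i
lincomb-scale a [] i = sym (ℚ.*-zeroʳ a)
lincomb-scale a ((c , w) ∷ L) i = trans (cong (a ℚ.* c ℚ.* w i ℚ.+_) (lincomb-scale a L i))
  (solve 4 (λ a c w r → a :* c :* w :+ a :* r := a :* (c :* w :+ r)) refl a c (w i) (lincomb L i))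

InSpan-isSubspace : (S : Pred Poly 0ℓ) → IsSubspace (InSpan S)
resp-≐ (InSpan-isSubspace S) p≐q (L , L⊆S , p≐L) = L , L⊆S , λ i → trans (sym (p≐q i)) (p≐L i)
0ₚ∈ (InSpan-isSubspace S) = [] , [] , λ _ → refl
⊕-closed (InSpan-isSubspace S) (L , L⊆S , p≐L) (L′ , L′⊆S , q≐L′) =
  L ++ L′ , ++⁺ L⊆S L′⊆S ,
  λ i → trans (cong₂ ℚ._+_ (p≐L i) (q≐L′ i)) (sym (lincomb-++ L L′ i))
⊙-closed (InSpan-isSubspace S) c (L , L⊆S , p≐L) =
  scaleCoeffs c L , map⁺ L⊆S , λ i → trans (cong (c ℚ.*_) (p≐L i)) (sym (lincomb-scale c L i))

InSpan-generator : ∀ {S : Pred Poly 0ℓ} {w} → S w → InSpan S w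
InSpan-generator {w = w} w∈S = (1ℚ , w) ∷ [] , w∈S ∷ [] ,
  λ i → sym (trans (ℚ.+-identityʳ _) (ℚ.*-identityˡ (w i)))

InSpan-least : ∀ {S W : Pred Poly 0ℓ} → IsSubspace W → (∀ {w} → S w → W w) →
  ∀ {v} → InSpan S v → W v
InSpan-least {S} {W} W-sub S⊆W (L , L⊆S , v≐L) = resp-≐ W-sub (λ i → sym (v≐L i)) (lincomb∈ L L⊆S)
  where
  lincomb∈ : ∀ L → All (λ cw → S (proj₂ cw)) L → W (lincomb L)
  lincomb∈ [] [] = 0ₚ∈ W-sub
  lincomb∈ ((c , w) ∷ L) (w∈S ∷ L⊆S) =
    ⊕-closed W-sub (⊙-closed W-sub c (S⊆W w∈S)) (lincomb∈ L L⊆S)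

DegLe-isSubspace : ∀ D → IsSubspace (λ p → DegLe p D)
resp-≐ (DegLe-isSubspace D) p≐q p≤D i D<i = trans (sym (p≐q i)) (p≤D i D<i)
0ₚ∈ (DegLe-isSubspace D) _ _ = refl
⊕-closed (DegLe-isSubspace D) p≤D q≤D i D<i =
  trans (cong₂ ℚ._+_ (p≤D i D<i) (q≤D i D<i)) (ℚ.+-identityˡ 0ℚ)
⊙-closed (DegLe-isSubspace D) c p≤D i D<i = trans (cong (c ℚ.*_) (p≤D i D<i)) (ℚ.*-zeroʳ c)

sumUpTo-cong : ∀ m {f g : ℕ → ℚ} → (∀ d → d ≤ m → f d ≡ g d) → sumUpTo m f ≡ sumUpTo m g
sumUpTo-cong zero f≡g = f≡g 0 z≤n
sumUpTo-cong (suc m) f≡g =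
  cong₂ ℚ._+_ (sumUpTo-cong m (λ d d≤m → f≡g d (ℕ.m≤n⇒m≤1+n d≤m))) (f≡g (suc m) ℕ.≤-refl)

sumUpTo-zero : ∀ m {f : ℕ → ℚ} → (∀ d → d ≤ m → f d ≡ 0ℚ) → sumUpTo m f ≡ 0ℚ
sumUpTo-zero zero f≡0 = f≡0 0 z≤n
sumUpTo-zero (suc m) f≡0 = trans
  (cong₂ ℚ._+_ (sumUpTo-zero m (λ d d≤m → f≡0 d (ℕ.m≤n⇒m≤1+n d≤m))) (f≡0 (suc m) ℕ.≤-refl))
  (ℚ.+-identityˡ 0ℚ)

sumUpTo-+ : ∀ m (f g : ℕ → ℚ) → sumUpTo m (λ d → f d ℚ.+ g d) ≡ sumUpTo m f ℚ.+ sumUpTo m g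
sumUpTo-+ zero f g = refl
sumUpTo-+ (suc m) f g = trans (cong (ℚ._+ (f (suc m) ℚ.+ g (suc m))) (sumUpTo-+ m f g))
  (solve 4 (λ a b c d → (a :+ b) :+ (c :+ d) := (a :+ c) :+ (b :+ d)) refl
     (sumUpTo m f) (sumUpTo m g) (f (suc m)) (g (suc m)))

sumUpTo-* : ∀ m a (f : ℕ → ℚ) → sumUpTo m (λ d → a ℚ.* f d) ≡ a ℚ.* sumUpTo m f
sumUpTo-* zero a f = refl
sumUpTo-* (suc m) a f = trans (cong (ℚ._+ (a ℚ.* f (suc m))) (sumUpTo-* m a f))
  (sym (ℚ.*-distribˡ-+ a (sumUpTo m f) (f (suc m))))

sumUpTo-single : ∀ m d (f : ℕ → ℚ) → d ≤ m →
  (∀ d′ → d′ ≤ m → d′ ≢ d → f d′ ≡ 0ℚ) → sumUpTo m f ≡ f d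
sumUpTo-single zero zero f _ _ = refl
sumUpTo-single (suc m) d f d≤1+m others with d ℕ.≟ suc m
... | yes refl = trans (cong (ℚ._+ f (suc m)) (sumUpTo-zero m (λ d′ d′≤m →
        others d′ (ℕ.m≤n⇒m≤1+n d′≤m) (λ { refl → ℕ.<-irrefl refl (s≤s d′≤m) }))))
      (ℚ.+-identityˡ (f (suc m)))
... | no d≢1+m = trans
      (cong₂ ℚ._+_ (sumUpTo-single m d f (ℕ.≤-pred (ℕ.≤∧≢⇒< d≤1+m d≢1+m))
                     (λ d′ d′≤m → others d′ (ℕ.m≤n⇒m≤1+n d′≤m)))
                   (others (suc m) ℕ.≤-refl (λ e → d≢1+m (sym e))))
      (ℚ.+-identityʳ (f d))

sumFin-zero : ∀ {m} {f : Fin m → ℚ} → (∀ t → f t ≡ 0ℚ) → sumFin f ≡ 0ℚ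
sumFin-zero {zero} f≡0 = refl
sumFin-zero {suc m} f≡0 = trans (cong₂ ℚ._+_ (f≡0 fzero) (sumFin-zero (λ t → f≡0 (fsuc t))))
  (ℚ.+-identityˡ 0ℚ)

sumFin-cong : ∀ {m} {f g : Fin m → ℚ} → (∀ t → f t ≡ g t) → sumFin f ≡ sumFin g
sumFin-cong {zero} f≡g = refl
sumFin-cong {suc m} f≡g = cong₂ ℚ._+_ (f≡g fzero) (sumFin-cong (λ t → f≡g (fsuc t)))

sumFin-+ : ∀ {m} (f g : Fin m → ℚ) → sumFin (λ t → f t ℚ.+ g t) ≡ sumFin f ℚ.+ sumFin g
sumFin-+ {zero} f g = refl
sumFin-+ {suc m} f g = trans (cong (f fzero ℚ.+ g fzero ℚ.+_) (sumFin-+ (tail f) (tail g)))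
  (solve 4 (λ a b c d → (a :+ b) :+ (c :+ d) := (a :+ c) :+ (b :+ d)) refl
     (f fzero) (g fzero) (sumFin (tail f)) (sumFin (tail g)))

sumFin-* : ∀ {m} a (f : Fin m → ℚ) → sumFin (λ t → a ℚ.* f t) ≡ a ℚ.* sumFin f
sumFin-* {zero} a f = sym (ℚ.*-zeroʳ a)
sumFin-* {suc m} a f = trans (cong (a ℚ.* f fzero ℚ.+_) (sumFin-* a (tail f)))
  (sym (ℚ.*-distribˡ-+ a (f fzero) (sumFin (tail f))))

-- Degrees, shifts and divisibility

DegLe-weaken : ∀ {p D D′} → DegLe p D → D ≤ D′ → DegLe p D′
DegLe-weaken p≤D D≤D′ i D′<i = p≤D i (ℕ.≤-<-trans D≤D′ D′<i)

DegLe-pred : ∀ {p D} → DegLe p (suc D) → p (suc D) ≡ 0ℚ → DegLe p D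
DegLe-pred p≤1+D p[1+D]≡0 i D<i with ℕ.m≤n⇒m<n∨m≡n D<i
... | inj₁ 1+D<i = p≤1+D i 1+D<i
... | inj₂ refl = p[1+D]≡0

DegLe-0 : ∀ {p} → DegLe p 0 → p 0 ≡ 0ℚ → p ≐ 0ₚ
DegLe-0 p≤0 p0≡0 zero = p0≡0
DegLe-0 p≤0 p0≡0 (suc i) = p≤0 (suc i) (s≤s z≤n)

IsDeg-unique : ∀ {p d d′} → IsDeg p d → IsDeg p d′ → d ≡ d′
IsDeg-unique {d = d} {d′} (pd≢0 , p≤d) (pd′≢0 , p≤d′) with ℕ.<-cmp d d′
... | tri< d<d′ _ _ = ⊥-elim (pd′≢0 (p≤d d′ d<d′))
... | tri≈ _ d≡d′ _ = d≡d′
... | tri> _ _ d′<d = ⊥-elim (pd≢0 (p≤d′ d d′<d))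

IsDeg-resp : ∀ {p q d} → p ≐ q → IsDeg p d → IsDeg q d
IsDeg-resp {d = d} p≐q (pd≢0 , p≤d) = (λ qd≡0 → pd≢0 (trans (p≐q d) qd≡0)) ,
  λ i d<i → trans (sym (p≐q i)) (p≤d i d<i)

degree? : ∀ D p → DegLe p D → p ≐ 0ₚ ⊎ ∃ λ d → d ≤ D × IsDeg p d
degree? D p p≤D with p D ℚ.≟ 0ℚ
... | no pD≢0 = inj₂ (D , ℕ.≤-refl , pD≢0 , p≤D)
degree? zero p p≤0 | yes p0≡0 = inj₁ (DegLe-0 p≤0 p0≡0)
degree? (suc D) p p≤1+D | yes p[1+D]≡0 with degree? D p (DegLe-pred p≤1+D p[1+D]≡0)
... | inj₁ p≐0 = inj₁ p≐0
... | inj₂ (d , d≤D , p°d) = inj₂ (d , ℕ.m≤n⇒m≤1+n d≤D , p°d)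

shift-cong : ∀ s {p q} → p ≐ q → shift s p ≐ shift s q
shift-cong zero p≐q i = p≐q i
shift-cong (suc s) p≐q zero = refl
shift-cong (suc s) p≐q (suc i) = shift-cong s p≐q i

shift-DegLe : ∀ s {p d} → DegLe p d → DegLe (shift s p) (s + d)
shift-DegLe zero p≤d i d<i = p≤d i d<i
shift-DegLe (suc s) p≤d (suc i) (s≤s s+d<i) = shift-DegLe s p≤d i s+d<i

shift-top : ∀ s p d → shift s p (s + d) ≡ p d
shift-top zero p d = refl
shift-top (suc s) p d = shift-top s p d

shift-IsDeg : ∀ s {p d} → IsDeg p d → IsDeg (shift s p) (s + d)
shift-IsDeg s {p} {d} (pd≢0 , p≤d) = (λ e → pd≢0 (trans (sym (shift-top s p d)) e)) , shift-DegLe s p≤d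

shift-suc : ∀ s p → shift (suc s) p ≐ shift 1 (shift s p)
shift-suc s p zero = refl
shift-suc s p (suc i) = refl

shift-0ₚ : ∀ s → shift s 0ₚ ≐ 0ₚ
shift-0ₚ zero i = refl
shift-0ₚ (suc s) zero = refl
shift-0ₚ (suc s) (suc i) = shift-0ₚ s i

shift-⊕ : ∀ s p q → shift s (p ⊕ q) ≐ shift s p ⊕ shift s q
shift-⊕ zero p q i = refl
shift-⊕ (suc s) p q zero = sym (ℚ.+-identityˡ 0ℚ)
shift-⊕ (suc s) p q (suc i) = shift-⊕ s p q i

shift-⊙ : ∀ s c p → shift s (c ⊙ p) ≐ c ⊙ shift s p
shift-⊙ zero c p i = refl
shift-⊙ (suc s) c p zero = sym (ℚ.*-zeroʳ c)
shift-⊙ (suc s) c p (suc i) = shift-⊙ s c p i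

shift-preimage-isSubspace : ∀ s {W} → IsSubspace W → IsSubspace (λ h → W (shift s h))
resp-≐ (shift-preimage-isSubspace s W-sub) p≐q = resp-≐ W-sub (shift-cong s p≐q)
0ₚ∈ (shift-preimage-isSubspace s W-sub) =
  resp-≐ W-sub (λ i → sym (shift-0ₚ s i)) (0ₚ∈ W-sub)
⊕-closed (shift-preimage-isSubspace s W-sub) {p} {q} p∈ q∈ =
  resp-≐ W-sub (λ i → sym (shift-⊕ s p q i)) (⊕-closed W-sub p∈ q∈)
⊙-closed (shift-preimage-isSubspace s W-sub) c {p} p∈ =
  resp-≐ W-sub (λ i → sym (shift-⊙ s c p i)) (⊙-closed W-sub c p∈)

1ₚ : Poly
1ₚ zero = 1ℚ
1ₚ (suc _) = 0ℚ

mul-1ₚ : ∀ g → mul g 1ₚ ≐ g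
mul-1ₚ g zero = ℚ.*-identityʳ (g 0)
mul-1ₚ g (suc m) = trans
  (cong₂ ℚ._+_
    (sumUpTo-zero m (λ d d≤m →
      trans (cong (λ x → g d ℚ.* 1ₚ x) (ℕ.+-∸-assoc 1 d≤m)) (ℚ.*-zeroʳ (g d))))
    (trans (cong (λ x → g (suc m) ℚ.* 1ₚ x) (ℕ.n∸n≡0 (suc m))) (ℚ.*-identityʳ (g (suc m)))))
  (ℚ.+-identityˡ (g (suc m)))

mul-shift1 : ∀ g Q → mul g (shift 1 Q) ≐ shift 1 (mul g Q)
mul-shift1 g Q zero = ℚ.*-zeroʳ (g 0)
mul-shift1 g Q (suc m) = trans
  (cong₂ ℚ._+_
    (sumUpTo-cong m (λ d d≤m → cong (λ x → g d ℚ.* shift 1 Q x) (ℕ.+-∸-assoc 1 d≤m)))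
    (trans (cong (λ x → g (suc m) ℚ.* shift 1 Q x) (ℕ.n∸n≡0 (suc m))) (ℚ.*-zeroʳ (g (suc m)))))
  (ℚ.+-identityʳ (mul g Q m))

mul-⊕ : ∀ g Q Q′ → mul g (Q ⊕ Q′) ≐ mul g Q ⊕ mul g Q′
mul-⊕ g Q Q′ m = trans (sumUpTo-cong m (λ d _ → ℚ.*-distribˡ-+ (g d) (Q (m ∸ d)) (Q′ (m ∸ d))))
  (sumUpTo-+ m (λ d → g d ℚ.* Q (m ∸ d)) (λ d → g d ℚ.* Q′ (m ∸ d)))

mul-⊙ : ∀ g c Q → mul g (c ⊙ Q) ≐ c ⊙ mul g Q
mul-⊙ g c Q m = trans
  (sumUpTo-cong m (λ d _ → solve 3 (λ x y z → x :* (y :* z) := y :* (x :* z)) refl (g d) c (Q (m ∸ d))))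
  (sumUpTo-* m c (λ d → g d ℚ.* Q (m ∸ d)))

mul-0ₚ : ∀ g → mul g 0ₚ ≐ 0ₚ
mul-0ₚ g m = sumUpTo-zero m (λ d _ → ℚ.*-zeroʳ (g d))

IsPoly-⊕ : ∀ {p q} → IsPoly p → IsPoly q → IsPoly (p ⊕ q)
IsPoly-⊕ (a , p≤a) (b , q≤b) = a + b , ⊕-closed (DegLe-isSubspace (a + b))
  (DegLe-weaken p≤a (ℕ.m≤m+n a b)) (DegLe-weaken q≤b (ℕ.m≤n+m b a))

Divides-isSubspace : ∀ g → IsSubspace (Divides g)
resp-≐ (Divides-isSubspace g) p≐q (Q , Q-poly , gQ≐p) = Q , Q-poly , λ i → trans (gQ≐p i) (p≐q i)
0ₚ∈ (Divides-isSubspace g) = 0ₚ , (0 , λ _ _ → refl) , mul-0ₚ g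
⊕-closed (Divides-isSubspace g) (Q , Q-poly , gQ≐p) (Q′ , Q′-poly , gQ′≐q) =
  Q ⊕ Q′ , IsPoly-⊕ Q-poly Q′-poly ,
  λ i → trans (mul-⊕ g Q Q′ i) (cong₂ ℚ._+_ (gQ≐p i) (gQ′≐q i))
⊙-closed (Divides-isSubspace g) c (Q , (a , Q≤a) , gQ≐p) =
  c ⊙ Q , (a , ⊙-closed (DegLe-isSubspace a) c Q≤a) ,
  λ i → trans (mul-⊙ g c Q i) (cong (c ℚ.*_) (gQ≐p i))

Divides-shift : ∀ g s → Divides g (shift s g)
Divides-shift g zero = 1ₚ , (0 , λ { (suc i) _ → refl }) , mul-1ₚ g
Divides-shift g (suc s) with Divides-shift g s
... | Q , (a , Q≤a) , gQ≐sg = shift 1 Q , (suc a , shift-DegLe 1 Q≤a) ,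
      λ i → trans (mul-shift1 g Q i) (trans (shift-cong 1 gQ≐sg i) (sym (shift-suc s g i)))

combination : ∀ {m} → (Fin m → ℚ) → (Fin m → Poly) → Poly
combination c u x = sumFin (λ t → c t ℚ.* u t x)

FamilySpan : ∀ {m} → (Fin m → Poly) → Pred Poly 0ℓ
FamilySpan u h = ∃ λ c → h ≐ combination c u

FamilySpan-isSubspace : ∀ {m} (u : Fin m → Poly) → IsSubspace (FamilySpan u)
resp-≐ (FamilySpan-isSubspace u) p≐q (c , p≐cu) = c , λ x → trans (sym (p≐q x)) (p≐cu x)
0ₚ∈ (FamilySpan-isSubspace u) = (λ _ → 0ℚ) , λ x → sym (sumFin-zero (λ t → ℚ.*-zeroˡ (u t x)))
⊕-closed (FamilySpan-isSubspace u) (c , p≐cu) (c′ , q≐c′u) = (λ t → c t ℚ.+ c′ t) , λ x →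
  trans (cong₂ ℚ._+_ (p≐cu x) (q≐c′u x))
    (trans (sym (sumFin-+ (λ t → c t ℚ.* u t x) (λ t → c′ t ℚ.* u t x)))
      (sumFin-cong (λ t → sym (ℚ.*-distribʳ-+ (u t x) (c t) (c′ t)))))
⊙-closed (FamilySpan-isSubspace u) a (c , p≐cu) = (λ t → a ℚ.* c t) , λ x →
  trans (cong (a ℚ.*_) (p≐cu x))
    (trans (sym (sumFin-* a (λ t → c t ℚ.* u t x)))
      (sumFin-cong (λ t → sym (ℚ.*-assoc a (c t) (u t x)))))

FamilySpan-⊆ : ∀ {m} {u : Fin m → Poly} {W} → IsSubspace W → (∀ t → W (u t)) →
  ∀ {h} → FamilySpan u h → W h
FamilySpan-⊆ {zero} W-sub u∈W (c , h≐0) = resp-≐ W-sub (λ x → sym (h≐0 x)) (0ₚ∈ W-sub)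
FamilySpan-⊆ {suc m} {u} W-sub u∈W (c , h≐cu) = resp-≐ W-sub (λ x → sym (h≐cu x))
  (⊕-closed W-sub (⊙-closed W-sub (c fzero) (u∈W fzero))
    (FamilySpan-⊆ W-sub (λ t → u∈W (fsuc t)) (tail c , λ _ → refl)))

combination-0◃ : ∀ {m} c (u : Fin (suc m) → Poly) → combination (0ℚ ◃ c) u ≐ combination c (tail u)
combination-0◃ c u x = trans (cong (ℚ._+ combination c (tail u) x) (ℚ.*-zeroˡ (u fzero x)))
  (ℚ.+-identityˡ _)

combination-head : ∀ {m} a (u : Fin (suc m) → Poly) → combination (a ◃ λ _ → 0ℚ) u ≐ a ⊙ u fzero
combination-head a u x = trans (cong (a ℚ.* u fzero x ℚ.+_) (sumFin-zero (λ t → ℚ.*-zeroˡ (u (fsuc t) x))))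
  (ℚ.+-identityʳ _)

FamilySpan-tail : ∀ {m} {u : Fin (suc m) → Poly} {h} → FamilySpan (tail u) h → FamilySpan u h
FamilySpan-tail {u = u} (c , h≐cu) = 0ℚ ◃ c , λ x → trans (h≐cu x) (sym (combination-0◃ c u x))

FamilySpan-head : ∀ {m} (u : Fin (suc m) → Poly) → FamilySpan u (u fzero)
FamilySpan-head u = 1ℚ ◃ (λ _ → 0ℚ) , λ x → sym (trans (combination-head 1ℚ u x) (ℚ.*-identityˡ _))

LinIndep-tail : ∀ {m} {u : Fin (suc m) → Poly} → LinIndep u → LinIndep (tail u)
LinIndep-tail {u = u} u-indep c cu≐0 t =
  u-indep (0ℚ ◃ c) (λ x → trans (combination-0◃ c u x) (cu≐0 x)) (fsuc t)

LinIndep⇒head∉tailSpan : ∀ {m} {u : Fin (suc m) → Poly} → LinIndep u → ¬ FamilySpan (tail u) (u fzero)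
LinIndep⇒head∉tailSpan {u = u} u-indep (c , u₀≐cu) = -1≢0 (u-indep (ℚ.- 1ℚ ◃ c) relation fzero)
  where
  -1≢0 : ℚ.- 1ℚ ≢ 0ℚ
  -1≢0 ()
  relation : ∀ x → combination (ℚ.- 1ℚ ◃ c) u x ≡ 0ℚ
  relation x = begin
    ℚ.- 1ℚ ℚ.* u fzero x ℚ.+ combination c (tail u) x
      ≡⟨ cong (ℚ.- 1ℚ ℚ.* u fzero x ℚ.+_) (sym (u₀≐cu x)) ⟩
    ℚ.- 1ℚ ℚ.* u fzero x ℚ.+ u fzero x
      ≡⟨ solve 1 (λ y → :- con 1ℚ :* y :+ y := con 0ℚ) refl (u fzero x) ⟩
    0ℚ ∎
    where open ≡-Reasoning

LinIndep⇒nonzero : ∀ {m} {u : Fin m → Poly} → LinIndep u → ∀ t → ¬ (u t ≐ 0ₚ)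
LinIndep⇒nonzero {u = u} u-indep fzero u₀≐0 = 1≢0 (u-indep (1ℚ ◃ λ _ → 0ℚ) relation fzero)
  where
  1≢0 : 1ℚ ≢ 0ℚ
  1≢0 ()
  relation : ∀ x → combination (1ℚ ◃ λ _ → 0ℚ) u x ≡ 0ℚ
  relation x = trans (combination-head 1ℚ u x) (trans (ℚ.*-identityˡ _) (u₀≐0 x))
LinIndep⇒nonzero {u = u} u-indep (fsuc t) = LinIndep⇒nonzero (LinIndep-tail {u = u} u-indep) t

padZero : ∀ {m m′} → m ≤ m′ → (Fin m → ℚ) → Fin m′ → ℚ
padZero z≤n c _ = 0ℚ
padZero (s≤s m≤m′) c = c fzero ◃ padZero m≤m′ (tail c)

padZero-inject≤ : ∀ {m m′} (m≤m′ : m ≤ m′) c t → padZero m≤m′ c (inject≤ t m≤m′) ≡ c t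
padZero-inject≤ (s≤s m≤m′) c fzero = refl
padZero-inject≤ (s≤s m≤m′) c (fsuc t) = padZero-inject≤ m≤m′ (tail c) t

combination-padZero : ∀ {m m′} (m≤m′ : m ≤ m′) c (u : Fin m′ → Poly) →
  combination (padZero m≤m′ c) u ≐ combination c (λ t → u (inject≤ t m≤m′))
combination-padZero z≤n c u x = sumFin-zero (λ t → ℚ.*-zeroˡ (u t x))
combination-padZero (s≤s m≤m′) c u x =
  cong (c fzero ℚ.* u fzero x ℚ.+_) (combination-padZero m≤m′ (tail c) (tail u) x)

LinIndep-inject≤ : ∀ {m m′} {u : Fin m′ → Poly} (m≤m′ : m ≤ m′) → LinIndep u →
  LinIndep (λ t → u (inject≤ t m≤m′))
LinIndep-inject≤ {u = u} m≤m′ u-indep c cu≐0 t = trans (sym (padZero-inject≤ m≤m′ c t))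
  (u-indep (padZero m≤m′ c) (λ x → trans (combination-padZero m≤m′ c u x) (cu≐0 x))
    (inject≤ t m≤m′))

StrictlyDecreasing : ∀ {m} → (Fin m → ℕ) → Set
StrictlyDecreasing {zero} δ = ⊤
StrictlyDecreasing {suc m} δ = (∀ t → tail δ t < δ fzero) × StrictlyDecreasing (tail δ)

LinIndep-decreasingDegrees : ∀ {m} (u : Fin m → Poly) (δ : Fin m → ℕ) → StrictlyDecreasing δ →
  (∀ t → IsDeg (u t) (δ t)) → LinIndep u
LinIndep-decreasingDegrees {suc m} u δ (tail<head , δ-dec) u°δ c cu≐0 = coefficient≡0
  where
  top = δ fzero
  c₀≡0 : c fzero ≡ 0ℚ
  c₀≡0 = p*q≡0⇒p≡0 (c fzero) (u fzero top) (proj₁ (u°δ fzero)) (begin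
    c fzero ℚ.* u fzero top        ≡⟨ sym (ℚ.+-identityʳ _) ⟩
    c fzero ℚ.* u fzero top ℚ.+ 0ℚ ≡⟨ cong (c fzero ℚ.* u fzero top ℚ.+_) (sym tail-vanishes) ⟩
    combination c u top            ≡⟨ cu≐0 top ⟩
    0ℚ                             ∎)
    where
    open ≡-Reasoning
    tail-vanishes : combination (tail c) (tail u) top ≡ 0ℚ
    tail-vanishes = sumFin-zero (λ t →
      trans (cong (c (fsuc t) ℚ.*_) (proj₂ (u°δ (fsuc t)) top (tail<head t))) (ℚ.*-zeroʳ (c (fsuc t))))
  coefficient≡0 : ∀ t → c t ≡ 0ℚ
  coefficient≡0 fzero = c₀≡0
  coefficient≡0 (fsuc t) = LinIndep-decreasingDegrees (tail u) (tail δ) δ-dec (λ t → u°δ (fsuc t)) (tail c)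
    (λ x → trans (sym (combination-0◃ (tail c) u x))
      (trans (cong (λ a → a ℚ.* u fzero x ℚ.+ combination (tail c) (tail u) x) (sym c₀≡0)) (cu≐0 x)))
    t

-- Counting

module _ {P : Pred ℕ 0ℓ} (P? : Decidable P) where

  count : ℕ → ℕ
  count zero = 0
  count (suc m) with P? m
  ... | yes _ = suc (count m)
  ... | no _ = count m

  count-suc : ∀ m → P m → count (suc m) ≡ suc (count m)
  count-suc m Pm with P? m
  ... | yes _ = refl
  ... | no ¬Pm = ⊥-elim (¬Pm Pm)

  count≤ : ∀ m → count m ≤ m
  count≤ zero = z≤n
  count≤ (suc m) with P? m
  ... | yes _ = s≤s (count≤ m)
  ... | no _ = ℕ.m≤n⇒m≤1+n (count≤ m)

  count-monoʳ : ∀ {m m′} → m ≤ m′ → count m ≤ count m′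
  count-monoʳ {m′ = zero} z≤n = z≤n
  count-monoʳ {m} {suc m′} m≤1+m′ with ℕ.m≤n⇒m<n∨m≡n m≤1+m′
  ... | inj₂ refl = ℕ.≤-refl
  ... | inj₁ (s≤s m≤m′) with P? m′
  ...   | yes _ = ℕ.m≤n⇒m≤1+n (count-monoʳ m≤m′)
  ...   | no _ = count-monoʳ m≤m′

  all⇒count≥ : ∀ m → (∀ d → d < m → P d) → m ≤ count m
  all⇒count≥ zero _ = z≤n
  all⇒count≥ (suc m) all = ℕ.≤-trans (s≤s (all⇒count≥ m (λ d d<m → all d (ℕ.m≤n⇒m≤1+n d<m))))
    (ℕ.≤-reflexive (sym (count-suc m (all m ℕ.≤-refl))))

  count≥⇒all : ∀ m → m ≤ count m → ∀ d → d < m → P d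
  count≥⇒all (suc m) m<count d d<1+m with P? m
  ... | no _ = ⊥-elim (ℕ.<-irrefl refl (ℕ.≤-trans m<count (count≤ m)))
  ... | yes Pm with ℕ.m≤n⇒m<n∨m≡n (ℕ.≤-pred d<1+m)
  ...   | inj₁ d<m = count≥⇒all m (ℕ.≤-pred m<count) d d<m
  ...   | inj₂ refl = Pm

  count-pick : ∀ m r → r ≤ count m →
    Σ (Fin r → ℕ) λ δ → StrictlyDecreasing δ × (∀ t → δ t < m × P (δ t))
  count-pick m zero _ = (λ ()) , _ , λ ()
  count-pick (suc m) (suc r) r<count with P? m
  ... | no _ = let δ , δ-dec , δ-ok = count-pick m (suc r) r<count in
               δ , δ-dec , λ t → ℕ.m≤n⇒m≤1+n (proj₁ (δ-ok t)) , proj₂ (δ-ok t)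
  ... | yes Pm = let δ , δ-dec , δ-ok = count-pick m r (ℕ.≤-pred r<count) in
                 m ◃ δ , ((λ t → proj₁ (δ-ok t)) , δ-dec) , λ
                   { fzero → ℕ.≤-refl , Pm
                   ; (fsuc t) → ℕ.m≤n⇒m≤1+n (proj₁ (δ-ok t)) , proj₂ (δ-ok t) }

module _ {P Q : Pred ℕ 0ℓ} (P? : Decidable P) (Q? : Decidable Q) where

  private
    restrict : ∀ {m} → (∀ d → d < suc m → P d → Q d) → ∀ d → d < m → P d → Q d
    restrict P⊆Q d d<m = P⊆Q d (ℕ.m≤n⇒m≤1+n d<m)

  count-mono : ∀ m → (∀ d → d < m → P d → Q d) → count P? m ≤ count Q? m
  count-mono zero _ = z≤n
  count-mono (suc m) P⊆Q with P? m | Q? m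
  ... | yes _ | yes _ = s≤s (count-mono m (restrict P⊆Q))
  ... | yes Pm | no ¬Qm = ⊥-elim (¬Qm (P⊆Q m ℕ.≤-refl Pm))
  ... | no _ | yes _ = ℕ.m≤n⇒m≤1+n (count-mono m (restrict P⊆Q))
  ... | no _ | no _ = count-mono m (restrict P⊆Q)

  count-new : ∀ m → (∀ d → d < m → P d → Q d) → ∀ y → y < m → ¬ P y → Q y →
    suc (count P? m) ≤ count Q? m
  count-new (suc m) P⊆Q y y<1+m ¬Py Qy with ℕ.m≤n⇒m<n∨m≡n (ℕ.≤-pred y<1+m) | P? m | Q? m
  ... | _ | yes Pm | no ¬Qm = ⊥-elim (¬Qm (P⊆Q m ℕ.≤-refl Pm))
  ... | inj₂ refl | yes Py | _ = ⊥-elim (¬Py Py)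
  ... | inj₂ refl | _ | no ¬Qy = ⊥-elim (¬Qy Qy)
  ... | inj₂ refl | no _ | yes _ = s≤s (count-mono m (restrict P⊆Q))
  ... | inj₁ y<m | yes _ | yes _ = s≤s (count-new m (restrict P⊆Q) y y<m ¬Py Qy)
  ... | inj₁ y<m | no _ | yes _ = ℕ.m≤n⇒m≤1+n (count-new m (restrict P⊆Q) y y<m ¬Py Qy)
  ... | inj₁ y<m | no _ | no _ = count-new m (restrict P⊆Q) y y<m ¬Py Qy

  -- P and Q stand for the degree sets of W_M and W_{M+1}.
  count-grows : ∀ M → (∀ d → d ≤ M → P d → Q d) → (∀ d → d ≤ M → P d → Q (suc d)) →
    P M →
    (∀ b → (∀ d → b ≤ d → d ≤ M → P d) → (∀ d → d < b → ¬ Q d) → b ≡ 0) →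
    2 + count P? (suc M) ≤ count Q? (2 + M) ⊎ 2 + M ≤ count Q? (2 + M)
  count-grows M P⊆Q P⊆Q∘suc PM no-stagnation with ℕ.anyUpTo? (λ y → ¬? (P? y) ×-dec Q? y) (suc M)
  ... | yes (y , y≤M , ¬Py , Qy) = inj₁ (begin
    2 + count P? (suc M)
      ≤⟨ s≤s (count-new (suc M) (λ d d≤M → P⊆Q d (ℕ.≤-pred d≤M)) y y≤M ¬Py Qy) ⟩
    suc (count Q? (suc M))
      ≡⟨ sym (count-suc Q? (suc M) Q[1+M]) ⟩
    count Q? (2 + M) ∎)
    where
    open ℕ.≤-Reasoning
    Q[1+M] = P⊆Q∘suc M ℕ.≤-refl PM
  ... | no ∄y = inj₂ (begin
    2 + M
      ≤⟨ s≤s (all⇒count≥ Q? (suc M) λ d d≤M → P⊆Q d (ℕ.≤-pred d≤M) (P-below-M d (ℕ.≤-pred d≤M))) ⟩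
    suc (count Q? (suc M))
      ≡⟨ sym (count-suc Q? (suc M) (P⊆Q∘suc M ℕ.≤-refl PM)) ⟩
    count Q? (2 + M) ∎)
    where
    open ℕ.≤-Reasoning
    Q⊆P : ∀ d → d ≤ M → Q d → P d
    Q⊆P d d≤M Qd with P? d
    ... | yes Pd = Pd
    ... | no ¬Pd = ⊥-elim (∄y (d , s≤s d≤M , ¬Pd , Qd))
    upward : ∀ {b d} → b ≤ d → d ≤ M → P b → P d
    upward b≤d d≤M Pb with ℕ.m≤n⇒m<n∨m≡n b≤d
    ... | inj₂ refl = Pb
    upward {d = suc d} _ d<M Pb | inj₁ (s≤s b≤d) =
      Q⊆P (suc d) d<M (P⊆Q∘suc d (ℕ.<⇒≤ d<M) (upward b≤d (ℕ.<⇒≤ d<M) Pb))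
    downward : ∀ b → b ≤ M → (∀ d → b ≤ d → d ≤ M → P d) → ∀ d → d ≤ M → P d
    downward zero _ P-above d = P-above d z≤n
    downward (suc b) b<M P-above with P? b
    ... | yes Pb = downward b (ℕ.<⇒≤ b<M) λ d b≤d d≤M →
      [ (λ b<d → P-above d b<d d≤M) , (λ { refl → Pb }) ]′ (ℕ.m≤n⇒m<n∨m≡n b≤d)
    ... | no ¬Pb = ⊥-elim (ℕ.1+n≢0 (no-stagnation (suc b) P-above λ d d≤b Qd →
      ¬Pb (upward (ℕ.≤-pred d≤b) (ℕ.<⇒≤ b<M)
        (Q⊆P d (ℕ.≤-trans (ℕ.≤-pred d≤b) (ℕ.<⇒≤ b<M)) Qd))))
    P-below-M : ∀ d → d ≤ M → P d
    P-below-M = downward M ℕ.≤-refl λ d M≤d d≤M → subst P (ℕ.≤-antisym M≤d d≤M) PM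

-- Echelon tables

module _ (p : Poly) (D : ℕ) (pD≢0 : p D ≢ 0ℚ) where
  private instance _ = ℚ.≢-nonZero pD≢0

  topRatio : Poly → ℚ
  topRatio h = h D ℚ.* ℚ.1/ p D

  cancelTop : Poly → Poly
  cancelTop h = h ⊕ ℚ.- topRatio h ⊙ p

  cancelTop-top : ∀ h → cancelTop h D ≡ 0ℚ
  cancelTop-top h = begin
    h D ℚ.+ ℚ.- r ℚ.* p D      ≡⟨ cong (h D ℚ.+_) (sym (ℚ.neg-distribˡ-* r (p D))) ⟩
    h D ℚ.+ ℚ.- (r ℚ.* p D)    ≡⟨ cong (λ x → h D ℚ.+ ℚ.- x) r*pD≡hD ⟩
    h D ℚ.+ ℚ.- h D            ≡⟨ ℚ.+-inverseʳ (h D) ⟩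
    0ℚ                         ∎
    where
    open ≡-Reasoning
    r = topRatio h
    r*pD≡hD : r ℚ.* p D ≡ h D
    r*pD≡hD = begin
      h D ℚ.* ℚ.1/ p D ℚ.* p D     ≡⟨ ℚ.*-assoc (h D) _ (p D) ⟩
      h D ℚ.* (ℚ.1/ p D ℚ.* p D)   ≡⟨ cong (h D ℚ.*_) (ℚ.*-inverseˡ (p D)) ⟩
      h D ℚ.* 1ℚ                   ≡⟨ ℚ.*-identityʳ (h D) ⟩
      h D                          ∎

  cancelTop-inverse : ∀ h → h ≐ cancelTop h ⊕ topRatio h ⊙ p
  cancelTop-inverse h i =
    solve 3 (λ x r y → x := x :+ (:- r) :* y :+ r :* y) refl (h i) (topRatio h) (p i)

record Echelon (W : Pred Poly 0ℓ) : Set where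
  field
    slot : ℕ → Poly
    slot∈ : ∀ d → W (slot d)
    slot-deg : ∀ d → DegLe (slot d) d
    slot-empty : ∀ d → slot d d ≡ 0ℚ → slot d ≐ 0ₚ

  Filled : Pred ℕ 0ℓ
  Filled d = slot d d ≢ 0ℚ

  filled? : Decidable Filled
  filled? d = ¬? (slot d d ℚ.≟ 0ℚ)

  SpannedBy : ℕ → Pred Poly 0ℓ
  SpannedBy D h = Σ (ℕ → ℚ) λ c → h ≐ λ i → sumUpTo D (λ d → c d ℚ.* slot d i)

open Echelon

module _ {W : Pred Poly 0ℓ} (T : Echelon W) where

  slot-IsDeg : ∀ {d} → Filled T d → IsDeg (slot T d) d
  slot-IsDeg {d} filled = filled , slot-deg T d

  SpannedBy-isSubspace : ∀ D → IsSubspace (SpannedBy T D)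
  resp-≐ (SpannedBy-isSubspace D) p≐q (c , p≐) = c , λ i → trans (sym (p≐q i)) (p≐ i)
  0ₚ∈ (SpannedBy-isSubspace D) =
    (λ _ → 0ℚ) , λ i → sym (sumUpTo-zero D (λ d _ → ℚ.*-zeroˡ (slot T d i)))
  ⊕-closed (SpannedBy-isSubspace D) (c , p≐) (c′ , q≐) = (λ d → c d ℚ.+ c′ d) , λ i →
    trans (cong₂ ℚ._+_ (p≐ i) (q≐ i))
      (trans (sym (sumUpTo-+ D (λ d → c d ℚ.* slot T d i) (λ d → c′ d ℚ.* slot T d i)))
        (sumUpTo-cong D (λ d _ → sym (ℚ.*-distribʳ-+ (slot T d i) (c d) (c′ d)))))
  ⊙-closed (SpannedBy-isSubspace D) a (c , p≐) = (λ d → a ℚ.* c d) , λ i →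
    trans (cong (a ℚ.*_) (p≐ i))
      (trans (sym (sumUpTo-* D a (λ d → c d ℚ.* slot T d i)))
        (sumUpTo-cong D (λ d _ → sym (ℚ.*-assoc a (c d) (slot T d i)))))

  SpannedBy-⊆ : ∀ {V : Pred Poly 0ℓ} → IsSubspace V → ∀ D → (∀ d → d ≤ D → V (slot T d)) →
    ∀ {h} → SpannedBy T D h → V h
  SpannedBy-⊆ {V} V-sub D slots∈V (c , h≐) =
    resp-≐ V-sub (λ i → sym (h≐ i)) (partialSums∈ D ℕ.≤-refl)
    where
    partialSums∈ : ∀ D′ → D′ ≤ D → V (λ i → sumUpTo D′ (λ d → c d ℚ.* slot T d i))
    partialSums∈ zero _ = ⊙-closed V-sub (c 0) (slots∈V 0 z≤n)
    partialSums∈ (suc D′) D′<D = ⊕-closed V-sub (partialSums∈ D′ (ℕ.<⇒≤ D′<D))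
      (⊙-closed V-sub (c (suc D′)) (slots∈V (suc D′) D′<D))

  slot-SpannedBy : ∀ {d D} → d ≤ D → SpannedBy T D (slot T d)
  slot-SpannedBy {d} {D} d≤D = c , λ i →
    sym (trans (sumUpTo-single D d _ d≤D (λ d′ _ d′≢d → other-term d′ i d′≢d)) (own-term i))
    where
    c : ℕ → ℚ
    c d′ with d′ ℕ.≟ d
    ... | yes _ = 1ℚ
    ... | no _ = 0ℚ
    own-term : ∀ i → c d ℚ.* slot T d i ≡ slot T d i
    own-term i with d ℕ.≟ d
    ... | yes _ = ℚ.*-identityˡ (slot T d i)
    ... | no d≢d = ⊥-elim (d≢d refl)
    other-term : ∀ d′ i → d′ ≢ d → c d′ ℚ.* slot T d′ i ≡ 0ℚ
    other-term d′ i d′≢d with d′ ℕ.≟ d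
    ... | yes d′≡d = ⊥-elim (d′≢d d′≡d)
    ... | no _ = ℚ.*-zeroˡ (slot T d′ i)

  SpannedBy-suc : ∀ D {h} → SpannedBy T D h → SpannedBy T (suc D) h
  SpannedBy-suc D = SpannedBy-⊆ (SpannedBy-isSubspace (suc D)) D
    (λ d d≤D → slot-SpannedBy (ℕ.m≤n⇒m≤1+n d≤D))

  SpannedBy⇒∈ : IsSubspace W → ∀ {D h} → SpannedBy T D h → W h
  SpannedBy⇒∈ W-sub {D} = SpannedBy-⊆ W-sub D (λ d _ → slot∈ T d)

  SpannedBy-top : ∀ D {h} ((c , _) : SpannedBy T D h) → h D ≡ c D ℚ.* slot T D D
  SpannedBy-top zero (c , h≐) = h≐ 0
  SpannedBy-top (suc D) (c , h≐) = trans (h≐ (suc D))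
    (trans (cong (ℚ._+ (c (suc D) ℚ.* slot T (suc D) (suc D)))
       (sumUpTo-zero D (λ d d≤D →
         trans (cong (c d ℚ.*_) (slot-deg T d (suc D) (s≤s d≤D))) (ℚ.*-zeroʳ (c d)))))
     (ℚ.+-identityˡ _))

  SpannedBy-pred : ∀ D {h} → SpannedBy T (suc D) h → h (suc D) ≡ 0ℚ → SpannedBy T D h
  SpannedBy-pred D (c , h≐) h[1+D]≡0 = c , λ i →
    trans (h≐ i)
      (trans (cong (sumUpTo D (λ d → c d ℚ.* slot T d i) ℚ.+_) (top-term≡0 i)) (ℚ.+-identityʳ _))
    where
    top-term≡0 : ∀ i → c (suc D) ℚ.* slot T (suc D) i ≡ 0ℚ
    top-term≡0 i with slot T (suc D) (suc D) ℚ.≟ 0ℚ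
    ... | yes empty = trans (cong (c (suc D) ℚ.*_) (slot-empty T (suc D) empty i)) (ℚ.*-zeroʳ (c (suc D)))
    ... | no filled = trans (cong (ℚ._* slot T (suc D) i) c≡0) (ℚ.*-zeroˡ (slot T (suc D) i))
      where
      c≡0 = p*q≡0⇒p≡0 (c (suc D)) (slot T (suc D) (suc D)) filled
        (trans (sym (SpannedBy-top (suc D) (c , h≐))) h[1+D]≡0)

  SpannedBy⇒Filled : ∀ M {h D} → SpannedBy T M h → IsDeg h D → D ≤ M → Filled T D
  SpannedBy⇒Filled M (c , h≐) (hD≢0 , h≤D) D≤M with ℕ.m≤n⇒m<n∨m≡n D≤M
  ... | inj₂ refl = λ empty →
    hD≢0 (trans (SpannedBy-top M (c , h≐)) (trans (cong (c M ℚ.*_) empty) (ℚ.*-zeroʳ (c M))))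
  SpannedBy⇒Filled (suc M) sp h°D _ | inj₁ (s≤s D≤M) =
    SpannedBy⇒Filled M (SpannedBy-pred M sp (proj₂ h°D (suc M) (s≤s D≤M))) h°D D≤M

Echelon-map : ∀ {W W′ : Pred Poly 0ℓ} → (∀ {h} → W h → W′ h) → Echelon W → Echelon W′
Echelon-map W⊆W′ T = record
  { slot = slot T ; slot∈ = λ d → W⊆W′ (slot∈ T d) ; slot-deg = slot-deg T ; slot-empty = slot-empty T }

module _ {W : Pred Poly 0ℓ} where

  infix 4 _⊑_
  record _⊑_ (T T′ : Echelon W) : Set where
    constructor keeps
    field kept : ∀ d → Filled T d → slot T′ d ≐ slot T d

  open _⊑_

  ⊑-refl : ∀ {T} → T ⊑ T
  ⊑-refl = keeps λ _ _ _ → refl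

  ⊑-Filled : ∀ {T T′} → T ⊑ T′ → ∀ {d} → Filled T d → Filled T′ d
  ⊑-Filled T⊑T′ {d} filled empty = filled (trans (sym (kept T⊑T′ d filled d)) empty)

  ⊑-trans : ∀ {T T′ T″} → T ⊑ T′ → T′ ⊑ T″ → T ⊑ T″
  ⊑-trans T⊑T′ T′⊑T″ = keeps λ d filled i →
    trans (kept T′⊑T″ d (⊑-Filled T⊑T′ filled) i) (kept T⊑T′ d filled i)

  SpannedBy-⊑ : ∀ {T T′} → T ⊑ T′ → ∀ D {h} → SpannedBy T D h → SpannedBy T′ D h
  SpannedBy-⊑ {T} {T′} T⊑T′ D = SpannedBy-⊆ T (SpannedBy-isSubspace T′ D) D slot∈span
    where
    slot∈span : ∀ d → d ≤ D → SpannedBy T′ D (slot T d)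
    slot∈span d d≤D with slot T d d ℚ.≟ 0ℚ
    ... | yes empty = resp-≐ (SpannedBy-isSubspace T′ D) (λ i → sym (slot-empty T d empty i))
                        (0ₚ∈ (SpannedBy-isSubspace T′ D))
    ... | no filled = resp-≐ (SpannedBy-isSubspace T′ D) (kept T⊑T′ d filled) (slot-SpannedBy T′ d≤D)

  place : (T : Echelon W) (D : ℕ) (h : Poly) → W h → IsDeg h D → Echelon W
  slot (place T D h _ _) d with d ℕ.≟ D
  ... | yes _ = h
  ... | no _ = slot T d
  slot∈ (place T D h h∈ _) d with d ℕ.≟ D
  ... | yes _ = h∈
  ... | no _ = slot∈ T d
  slot-deg (place T D h _ h°D) d with d ℕ.≟ D
  ... | yes refl = proj₂ h°D
  ... | no _ = slot-deg T d
  slot-empty (place T D h _ h°D) d with d ℕ.≟ D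
  ... | yes refl = λ hD≡0 → ⊥-elim (proj₁ h°D hD≡0)
  ... | no _ = slot-empty T d

  module _ (T : Echelon W) (D : ℕ) (h : Poly) (h∈ : W h) (h°D : IsDeg h D) where

    place-slot : slot (place T D h h∈ h°D) D ≡ h
    place-slot with D ℕ.≟ D
    ... | yes _ = refl
    ... | no D≢D = ⊥-elim (D≢D refl)

    place-Filled : Filled (place T D h h∈ h°D) D
    place-Filled = subst (λ p → p D ≢ 0ℚ) (sym place-slot) (proj₁ h°D)

    place-SpannedBy : SpannedBy (place T D h h∈ h°D) D h
    place-SpannedBy = subst (SpannedBy (place T D h h∈ h°D) D) place-slot
      (slot-SpannedBy (place T D h h∈ h°D) {D} ℕ.≤-refl)

    place-⊑ : ¬ Filled T D → T ⊑ place T D h h∈ h°D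
    place-⊑ ¬filled = keeps kept′
      where
      kept′ : ∀ d → Filled T d → slot (place T D h h∈ h°D) d ≐ slot T d
      kept′ d filled with d ℕ.≟ D
      ... | yes refl = ⊥-elim (¬filled filled)
      ... | no _ = λ _ → refl

  record Insertion (T : Echelon W) (D : ℕ) (h : Poly) : Set where
    field
      result : Echelon W
      extends : T ⊑ result
      spans : SpannedBy result D h
      novelty : SpannedBy T D h ⊎ ∃ λ d → d ≤ D × ¬ Filled T d × Filled result d

  Insertion-suc : ∀ {T D h} → Insertion T D h → Insertion T (suc D) h
  Insertion-suc {T} {D} {h} I = record
    { result = result ; extends = extends ; spans = SpannedBy-suc result D spans
    ; novelty = Sum.map (SpannedBy-suc T D) widen novelty }
    where
    open Insertion I
    widen : (∃ λ d → d ≤ D × ¬ Filled T d × Filled result d) →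
      ∃ λ d → d ≤ suc D × ¬ Filled T d × Filled result d
    widen (d , d≤D , new) = d , ℕ.m≤n⇒m≤1+n d≤D , new

  module _ (W-sub : IsSubspace W) where

    insert : ∀ T D h → W h → DegLe h D → Insertion T D h
    insertBelow : ∀ T D h → W h → DegLe h D → h D ≡ 0ℚ → Insertion T D h

    insert T D h h∈ h≤D with h D ℚ.≟ 0ℚ
    ... | yes hD≡0 = insertBelow T D h h∈ h≤D hD≡0
    ... | no hD≢0 with filled? T D
    ...   | no ¬filled = record
      { result = place T D h h∈ (hD≢0 , h≤D) ; extends = place-⊑ T D h h∈ (hD≢0 , h≤D) ¬filled
      ; spans = place-SpannedBy T D h h∈ (hD≢0 , h≤D)
      ; novelty = inj₂ (D , ℕ.≤-refl , ¬filled , place-Filled T D h h∈ (hD≢0 , h≤D)) }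
    ...   | yes filled = record
      { result = result ; extends = extends
      ; spans = resp-≐ (SpannedBy-isSubspace result D) (λ i → sym (h≐ i))
          (axpy-closed (SpannedBy-isSubspace result D) r spans
            (resp-≐ (SpannedBy-isSubspace result D) (kept extends D filled) (slot-SpannedBy result ℕ.≤-refl)))
      ; novelty = Sum.map₁ (λ sp → resp-≐ (SpannedBy-isSubspace T D) (λ i → sym (h≐ i))
          (axpy-closed (SpannedBy-isSubspace T D) r sp (slot-SpannedBy T ℕ.≤-refl))) novelty }
      where
      pivot = slot T D
      r = topRatio pivot D filled h
      h′ = cancelTop pivot D filled h
      h≐ : h ≐ h′ ⊕ r ⊙ pivot
      h≐ = cancelTop-inverse pivot D filled h
      open Insertion (insertBelow T D h′ (axpy-closed W-sub (ℚ.- r) h∈ (slot∈ T D))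
        (axpy-closed (DegLe-isSubspace D) (ℚ.- r) h≤D (slot-deg T D)) (cancelTop-top pivot D filled h))

    insertBelow T zero h h∈ h≤0 h0≡0 =
      record { result = T ; extends = ⊑-refl ; spans = h-spanned ; novelty = inj₁ h-spanned }
      where
      h-spanned : SpannedBy T 0 h
      h-spanned = resp-≐ (SpannedBy-isSubspace T 0) (λ i → sym (DegLe-0 h≤0 h0≡0 i))
        (0ₚ∈ (SpannedBy-isSubspace T 0))
    insertBelow T (suc D) h h∈ h≤1+D h[1+D]≡0 =
      Insertion-suc (insert T D h h∈ (DegLe-pred h≤1+D h[1+D]≡0))

    insertShifts : ∀ T M (f : ℕ → Poly) S → (∀ s → s ≤ S → W (f s) × DegLe (f s) M) →
      Σ (Echelon W) λ T′ → T ⊑ T′ × (∀ s → s ≤ S → SpannedBy T′ M (f s))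
    insertShifts T M f zero f-ok = result , extends , λ { zero z≤n → spans }
      where open Insertion (insert T M (f 0) (proj₁ (f-ok 0 z≤n)) (proj₂ (f-ok 0 z≤n)))
    insertShifts T M f (suc S) f-ok with insertShifts T M f S (λ s s≤S → f-ok s (ℕ.m≤n⇒m≤1+n s≤S))
    ... | T₁ , T⊑T₁ , earlier = result , ⊑-trans T⊑T₁ extends , all-spanned
      where
      open Insertion
        (insert T₁ M (f (suc S)) (proj₁ (f-ok (suc S) ℕ.≤-refl)) (proj₂ (f-ok (suc S) ℕ.≤-refl)))
      all-spanned : ∀ s → s ≤ suc S → SpannedBy result M (f s)
      all-spanned s s≤1+S with ℕ.m≤n⇒m<n∨m≡n s≤1+S
      ... | inj₂ refl = spans
      ... | inj₁ (s≤s s≤S) = SpannedBy-⊑ extends M (earlier s s≤S)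

    insertFamily : ∀ T M {m} (F : Fin m → ℕ → Poly) (S : Fin m → ℕ) →
      (∀ i s → s ≤ S i → W (F i s) × DegLe (F i s) M) →
      Σ (Echelon W) λ T′ → T ⊑ T′ × (∀ i s → s ≤ S i → SpannedBy T′ M (F i s))
    insertFamily T M {zero} F S F-ok = T , ⊑-refl , λ ()
    insertFamily T M {suc m} F S F-ok with insertShifts T M (F fzero) (S fzero) (F-ok fzero)
    ... | T₁ , T⊑T₁ , head-spanned with insertFamily T₁ M (tail F) (tail S) (λ i → F-ok (fsuc i))
    ...   | T₂ , T₁⊑T₂ , tail-spanned = T₂ , ⊑-trans T⊑T₁ T₁⊑T₂ , λ
      { fzero s s≤S → SpannedBy-⊑ T₁⊑T₂ M (head-spanned s s≤S)
      ; (fsuc i) → tail-spanned i }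

emptyEchelon : ∀ {W} → IsSubspace W → Echelon W
emptyEchelon W-sub = record
  { slot = λ _ → 0ₚ ; slot∈ = λ _ → 0ₚ∈ W-sub
  ; slot-deg = λ _ _ _ → refl ; slot-empty = λ _ _ _ → refl }

module _ {U Z : Pred Poly 0ℓ} (U-sub : IsSubspace U) (Z-sub : IsSubspace Z) (pivot : ℕ → Poly) (M : ℕ)
  (pivot-ok : ∀ D {h} → D ≤ M → U h → IsDeg h D → IsDeg (pivot D) D × U (pivot D) × Z (pivot D)) where

  private
    reduce : ∀ D → D ≤ M → ∀ {h} → U h → DegLe h D → Z h
    reduceBelow : ∀ D → D ≤ M → ∀ {h} → U h → DegLe h D → h D ≡ 0ℚ → Z h

    reduce D D≤M {h} h∈U h≤D with h D ℚ.≟ 0ℚ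
    ... | yes hD≡0 = reduceBelow D D≤M h∈U h≤D hD≡0
    ... | no hD≢0 with pivot-ok D D≤M h∈U (hD≢0 , h≤D)
    ...   | (pD≢0 , p≤D) , p∈U , p∈Z = resp-≐ Z-sub (λ i → sym (cancelTop-inverse p D pD≢0 h i))
      (axpy-closed Z-sub r
        (reduceBelow D D≤M (axpy-closed U-sub (ℚ.- r) h∈U p∈U)
          (axpy-closed (DegLe-isSubspace D) (ℚ.- r) h≤D p≤D) (cancelTop-top p D pD≢0 h))
        p∈Z)
      where
      p = pivot D
      r = topRatio p D pD≢0 h

    reduceBelow zero _ h∈U h≤0 h0≡0 = resp-≐ Z-sub (λ i → sym (DegLe-0 h≤0 h0≡0 i)) (0ₚ∈ Z-sub)
    reduceBelow (suc D) D<M h∈U h≤1+D h[1+D]≡0 =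
      reduce D (ℕ.<⇒≤ D<M) h∈U (DegLe-pred h≤1+D h[1+D]≡0)

  pivots⇒⊆ : ∀ {h} → U h → DegLe h M → Z h
  pivots⇒⊆ = reduce M ℕ.≤-refl

module _ {W : Pred Poly 0ℓ} (T : Echelon W) where

  Echelon-DimGe : ∀ {r} m → r ≤ count (filled? T) m → DimGe W r
  Echelon-DimGe {r} m r≤count with count-pick (filled? T) m r r≤count
  ... | δ , δ-dec , δ-ok = (λ t → slot T (δ t)) , (λ t → slot∈ T (δ t)) ,
    LinIndep-decreasingDegrees _ δ δ-dec (λ t → slot-IsDeg T (proj₂ (δ-ok t)))

  Echelon-full : IsSubspace W → ∀ M → suc M ≤ count (filled? T) (suc M) → ∀ {v} → DegLe v M → W v
  Echelon-full W-sub M full v≤M = pivots⇒⊆ (DegLe-isSubspace M) W-sub (slot T) M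
    (λ D D≤M _ _ → slot-IsDeg T (count≥⇒all (filled? T) (suc M) full D (s≤s D≤M)) ,
                   DegLe-weaken (slot-deg T D) D≤M , slot∈ T D)
    v≤M v≤M

FamilySpan-Echelon : ∀ {m} (u : Fin m → Poly) → LinIndep u → ∀ D → (∀ t → DegLe (u t) D) →
  Σ (Echelon (FamilySpan u)) λ T → m ≤ count (filled? T) (suc D)
FamilySpan-Echelon {zero} u _ D _ = emptyEchelon (FamilySpan-isSubspace u) , z≤n
FamilySpan-Echelon {suc m} u u-indep D u≤D = result , count-increases
  where
  tail-table = FamilySpan-Echelon (tail u) (LinIndep-tail {u = u} u-indep) D (λ t → u≤D (fsuc t))
  T₀ = proj₁ tail-table
  T = Echelon-map (FamilySpan-tail {u = u}) T₀
  open Insertion (insert (FamilySpan-isSubspace u) T D (u fzero) (FamilySpan-head u) (u≤D fzero))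
  count-increases : suc m ≤ count (filled? result) (suc D)
  count-increases with novelty
  ... | inj₁ spanned = ⊥-elim (LinIndep⇒head∉tailSpan {u = u} u-indep
          (SpannedBy⇒∈ T₀ (FamilySpan-isSubspace (tail u)) {D} spanned))
  ... | inj₂ (d , d≤D , ¬filled , filled) = ℕ.≤-trans (s≤s (proj₂ tail-table))
          (count-new (filled? T) (filled? result) (suc D) (λ _ _ → ⊑-Filled extends)
             d (s≤s d≤D) ¬filled filled)

-- Growth of V_M(A)

module Generated (A : Pred Poly 0ℓ) (n : ℕ) (A-deg : ∀ {Q} → A Q → DegLe Q n) where

  generator-degree≤ : ∀ {Q d} → A Q → IsDeg Q d → d ≤ n
  generator-degree≤ {d = d} Q∈A (Qd≢0 , _) with d ℕ.≤? n
  ... | yes d≤n = d≤n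
  ... | no d≰n = ⊥-elim (Qd≢0 (A-deg Q∈A d (ℕ.≰⇒> d≰n)))

  V-isSubspace : ∀ M → IsSubspace (V M A)
  V-isSubspace M = InSpan-isSubspace (B M A)

  shift∈V : ∀ {M Q d s} → A Q → IsDeg Q d → s ≤ M ∸ d → V M A (shift s Q)
  shift∈V {Q = Q} {d} {s} Q∈A Q°d s≤M∸d =
    InSpan-generator (Q , Q∈A , d , Q°d , s , s≤M∸d , λ _ → refl)

  V-DegLe : ∀ {M} → n ≤ M → ∀ {h} → V M A h → DegLe h M
  V-DegLe {M} n≤M = InSpan-least (DegLe-isSubspace M) λ (Q , Q∈A , d , Q°d , s , s≤M∸d , w≐) →
    resp-≐ (DegLe-isSubspace M) (λ i → sym (w≐ i)) (DegLe-weaken (shift-DegLe s (proj₂ Q°d))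
      (ℕ.m≤o∸n⇒m+n≤o s (ℕ.≤-trans (generator-degree≤ Q∈A Q°d) n≤M) s≤M∸d))

  V-suc : ∀ {M h} → V M A h → V (suc M) A h
  V-suc {M} = InSpan-least (V-isSubspace (suc M)) λ (Q , Q∈A , d , Q°d , s , s≤M∸d , w≐) →
    InSpan-generator
      (Q , Q∈A , d , Q°d , s , ℕ.≤-trans s≤M∸d (ℕ.∸-monoˡ-≤ d (ℕ.n≤1+n M)) , w≐)

  V-shift : ∀ {M} → n ≤ M → ∀ {h} → V M A h → V (suc M) A (shift 1 h)
  V-shift {M} n≤M = InSpan-least (shift-preimage-isSubspace 1 (V-isSubspace (suc M)))
    λ (Q , Q∈A , d , Q°d , s , s≤M∸d , w≐) → InSpan-generator (Q , Q∈A , d , Q°d , suc s ,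
      subst (suc s ≤_) (sym (ℕ.+-∸-assoc 1 (ℕ.≤-trans (generator-degree≤ Q∈A Q°d) n≤M)))
        (s≤s s≤M∸d) ,
      λ i → trans (shift-cong 1 w≐ i) (sym (shift-suc s Q i)))

module Growth {j : ℕ} (A : Pred Poly 0ℓ) (n : ℕ) (G : Fin j → Poly)
  (G∈A : ∀ i → A (G i)) (A⊆G : ∀ {Q} → A Q → ∃ λ i → Q ≐ G i)
  (G-deg : ∀ i → DegLe (G i) n) (G-indep : LinIndep G)
  (i₀ i₁ : Fin j) (G-coprime : Coprime (G i₀) (G i₁)) where

  A-deg : ∀ {Q} → A Q → DegLe Q n
  A-deg Q∈A with A⊆G Q∈A
  ... | i , Q≐Gi = resp-≐ (DegLe-isSubspace n) (λ x → sym (Q≐Gi x)) (G-deg i)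

  open Generated A n A-deg

  G-degree : ∀ i → ∃ λ d → IsDeg (G i) d
  G-degree i with degree? n (G i) (G-deg i)
  ... | inj₁ Gi≐0 = ⊥-elim (LinIndep⇒nonzero G-indep i Gi≐0)
  ... | inj₂ (d , _ , Gi°d) = d , Gi°d

  degree : Fin j → ℕ
  degree i = proj₁ (G-degree i)

  G∈V : ∀ {M} i → V M A (G i)
  G∈V i = shift∈V (G∈A i) (proj₂ (G-degree i)) z≤n

  record Stage (M : ℕ) : Set where
    field
      table : Echelon (V M A)
      complete : ∀ {h} → V M A h → SpannedBy table M h
      count≥j : j ≤ count (filled? table) (suc M)

    V⇒Filled : ∀ {h D} → V M A h → IsDeg h D → D ≤ M → Filled table D
    V⇒Filled h∈V = SpannedBy⇒Filled table M (complete h∈V)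

  open Stage

  stage : ∀ M → n ≤ M → Stage M
  stage M n≤M = record
    { table = T ; complete = InSpan-least (SpannedBy-isSubspace T M) cover ; count≥j = j≤count }
    where
    initial = FamilySpan-Echelon G G-indep n G-deg
    T₀ : Echelon (V M A)
    T₀ = Echelon-map (FamilySpan-⊆ (V-isSubspace M) G∈V) (proj₁ initial)
    generator-ok : ∀ i s → s ≤ M ∸ degree i → V M A (shift s (G i)) × DegLe (shift s (G i)) M
    generator-ok i s s≤ = shift∈V (G∈A i) (proj₂ (G-degree i)) s≤ ,
      V-DegLe n≤M (shift∈V (G∈A i) (proj₂ (G-degree i)) s≤)
    extension = insertFamily (V-isSubspace M) T₀ M (λ i s → shift s (G i)) (λ i → M ∸ degree i) generator-ok
    T = proj₁ extension
    cover : ∀ {w} → B M A w → SpannedBy T M w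
    cover (Q , Q∈A , d , Q°d , s , s≤M∸d , w≐) with A⊆G Q∈A
    ... | i , Q≐Gi = resp-≐ (SpannedBy-isSubspace T M) (λ x → sym (trans (w≐ x) (shift-cong s Q≐Gi x)))
      (proj₂ (proj₂ extension) i s (subst (λ d → s ≤ M ∸ d) d≡degree s≤M∸d))
      where
      d≡degree : d ≡ degree i
      d≡degree = IsDeg-unique (IsDeg-resp Q≐Gi Q°d) (proj₂ (G-degree i))
    j≤count : j ≤ count (filled? T) (suc M)
    j≤count = ℕ.≤-trans (proj₂ initial) (ℕ.≤-trans
      (count-mono (filled? T₀) (filled? T) (suc n) (λ _ _ → ⊑-Filled (proj₁ (proj₂ extension))))
      (count-monoʳ (filled? T) (s≤s n≤M)))

  module Step {M : ℕ} (n≤M : n ≤ M) (St : Stage M) (St′ : Stage (suc M)) where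

    T = table St
    T′ = table St′

    Filled⇒≤ : ∀ {d} → Filled T d → d ≤ M
    Filled⇒≤ {d} filled with d ℕ.≤? M
    ... | yes d≤M = d≤M
    ... | no d≰M = ⊥-elim (filled (V-DegLe n≤M (slot∈ T d) d (ℕ.≰⇒> d≰M)))

    Filled-suc : ∀ {d} → Filled T d → Filled T′ d
    Filled-suc filled = V⇒Filled St′ (V-suc (slot∈ T _)) (slot-IsDeg T filled)
      (ℕ.m≤n⇒m≤1+n (Filled⇒≤ filled))

    Filled-shift : ∀ {d} → Filled T d → Filled T′ (suc d)
    Filled-shift filled = V⇒Filled St′ (V-shift n≤M (slot∈ T _)) (shift-IsDeg 1 (slot-IsDeg T filled))
      (s≤s (Filled⇒≤ filled))

    Filled-top : Filled T M
    Filled-top = V⇒Filled St (shift∈V (G∈A i₀) G°d ℕ.≤-refl)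
      (subst (IsDeg (shift (M ∸ d) (G i₀))) (ℕ.m∸n+n≡m d≤M) (shift-IsDeg (M ∸ d) G°d)) ℕ.≤-refl
      where
      d = degree i₀
      G°d = proj₂ (G-degree i₀)
      d≤M = ℕ.≤-trans (generator-degree≤ (G∈A i₀) G°d) n≤M

    module Stagnation (b : ℕ) (0<b : 0 < b) (filled-above : ∀ d → b ≤ d → d ≤ M → Filled T d)
      (empty-below : ∀ d → d < b → ¬ Filled T′ d) where

      degree≥b : ∀ {h D} → V (suc M) A h → IsDeg h D → D ≤ suc M → b ≤ D
      degree≥b {D = D} h∈V h°D D≤1+M with b ℕ.≤? D
      ... | yes b≤D = b≤D
      ... | no b≰D = ⊥-elim (empty-below D (ℕ.≰⇒> b≰D) (V⇒Filled St′ h∈V h°D D≤1+M))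

      b≤M : b ≤ M
      b≤M = degree≥b (slot∈ T′ M) (slot-IsDeg T′ (Filled-suc Filled-top)) (ℕ.n≤1+n M)

      g = slot T b

      g°b : IsDeg g b
      g°b = slot-IsDeg T (filled-above b ℕ.≤-refl b≤M)

      V-suc⇒V : ∀ {h} → V (suc M) A h → DegLe h M → V M A h
      V-suc⇒V = pivots⇒⊆ (V-isSubspace (suc M)) (V-isSubspace M) (slot T) M λ D D≤M h∈V h°D →
        let filled = filled-above D (degree≥b h∈V h°D (ℕ.m≤n⇒m≤1+n D≤M)) D≤M in
        slot-IsDeg T filled , V-suc (slot∈ T D) , slot∈ T D

      shift-g∈V : ∀ s → s ≤ M ∸ b → V M A (shift s g)
      shift-g∈V zero _ = slot∈ T b
      shift-g∈V (suc s) 1+s≤M∸b = V-suc⇒V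
        (resp-≐ (V-isSubspace (suc M)) (λ i → sym (shift-suc s g i))
          (V-shift n≤M (shift-g∈V s (ℕ.<⇒≤ 1+s≤M∸b))))
        (DegLe-weaken (shift-DegLe (suc s) (proj₂ g°b)) (ℕ.m≤o∸n⇒m+n≤o (suc s) b≤M 1+s≤M∸b))

      g-divides : ∀ {h} → V M A h → DegLe h M → Divides g h
      g-divides = pivots⇒⊆ (V-isSubspace M) (Divides-isSubspace g) (λ D → shift (D ∸ b) g) M
        λ D D≤M h∈V h°D → let b≤D = degree≥b (V-suc h∈V) h°D (ℕ.m≤n⇒m≤1+n D≤M) in
          subst (IsDeg (shift (D ∸ b) g)) (ℕ.m∸n+n≡m b≤D) (shift-IsDeg (D ∸ b) g°b) ,
          shift-g∈V (D ∸ b) (ℕ.∸-monoˡ-≤ b D≤M) , Divides-shift g (D ∸ b)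

      impossible : ⊥
      impossible = proj₁ g°b (G-coprime g (b , proj₂ g°b)
        (g-divides (G∈V i₀) (DegLe-weaken (G-deg i₀) n≤M))
        (g-divides (G∈V i₁) (DegLe-weaken (G-deg i₁) n≤M)) b 0<b)

    growth : 2 + count (filled? T) (suc M) ≤ count (filled? T′) (2 + M) ⊎ 2 + M ≤ count (filled? T′) (2 + M)
    growth = count-grows (filled? T) (filled? T′) M (λ _ _ → Filled-suc) (λ _ _ → Filled-shift) Filled-top
      λ { zero _ _ → refl ; (suc b) filled-above empty-below →
            ⊥-elim (Stagnation.impossible (suc b) (s≤s z≤n) filled-above empty-below) }

  stageAbove : ∀ e → Stage (e + n)
  stageAbove e = stage (e + n) (ℕ.m≤n+m n e)

  filledCount : ℕ → ℕ
  filledCount e = count (filled? (table (stageAbove e))) (suc (e + n))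

  filledCount-bound : ∀ e → 2 * e + j ≤ filledCount e ⊎ suc (e + n) ≤ filledCount e
  filledCount-bound zero = inj₁ (count≥j (stageAbove zero))
  filledCount-bound (suc e) =
    combine (filledCount-bound e) (Step.growth (ℕ.m≤n+m n e) (stageAbove e) (stageAbove (suc e)))
    where
    c = filledCount e
    c′ = filledCount (suc e)
    combine : 2 * e + j ≤ c ⊎ suc (e + n) ≤ c → 2 + c ≤ c′ ⊎ 2 + (e + n) ≤ c′ →
      2 * suc e + j ≤ c′ ⊎ suc (suc e + n) ≤ c′
    combine _ (inj₂ c′-full) = inj₂ c′-full
    combine (inj₁ c-bound) (inj₁ c′-bound) = inj₁ (begin
      2 * suc e + j    ≡⟨ cong (_+ j) (ℕ.*-suc 2 e) ⟩
      2 + (2 * e + j)  ≤⟨ s≤s (s≤s c-bound) ⟩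
      2 + c            ≤⟨ c′-bound ⟩
      c′               ∎)
      where open ℕ.≤-Reasoning
    combine (inj₂ c-full) (inj₁ c′-bound) =
      inj₂ (ℕ.≤-trans (s≤s (ℕ.n≤1+n (suc e + n))) (ℕ.≤-trans (s≤s (s≤s c-full)) c′-bound))

  V-DimGe : ∀ e {r} → r ≤ 2 * e + j → r ≤ suc (e + n) → DimGe (V (e + n) A) r
  V-DimGe e r≤2e+j r≤1+e+n = Echelon-DimGe (table (stageAbove e)) (suc (e + n))
    ([ ℕ.≤-trans r≤2e+j , ℕ.≤-trans r≤1+e+n ]′ (filledCount-bound e))

  V-full : ∀ e → suc (e + n) ≤ 2 * e + j → ∀ {v} → DegLe v (e + n) → V (e + n) A v
  V-full e 1+e+n≤2e+j = Echelon-full (table (stageAbove e)) (V-isSubspace (e + n)) (e + n)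
    ([ ℕ.≤-trans 1+e+n≤2e+j , (λ full → full) ]′ (filledCount-bound e))

toPoly-DegLe : ∀ {m} (a : Fin (suc m) → ℤ) → DegLe (toPoly a) m
toPoly-DegLe {zero} a (suc i) _ = refl
toPoly-DegLe {suc m} a (suc i) (s≤s m<i) = toPoly-DegLe (tail a) i m<i

module Prefix {n k} (P : Fin k → Fin (suc n) → ℤ) (P-indep : LinIndep (λ i → toPoly (P i)))
  (P-coprime : ∀ i i′ → toℕ i ≡ 0 → toℕ i′ ≡ 1 → Coprime (toPoly (P i)) (toPoly (P i′)))
  {j} (2≤j : 2 ≤ j) (j≤k : j ≤ k) where

  prefix : Fin j → Poly
  prefix i = toPoly (P (inject≤ i j≤k))

  prefix∈Gen : ∀ i → Gen P j (prefix i)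
  prefix∈Gen i =
    inject≤ i j≤k , subst (_< j) (sym (Fin.toℕ-inject≤ i j≤k)) (Fin.toℕ<n i) , λ _ → refl

  Gen⊆prefix : ∀ {Q} → Gen P j Q → ∃ λ i → Q ≐ prefix i
  Gen⊆prefix (i , i<j , Q≐Pi) =
    fromℕ< i<j , λ x → trans (Q≐Pi x) (cong (λ i → toPoly (P i) x) (sym inject≤-fromℕ<))
    where
    inject≤-fromℕ< : inject≤ (fromℕ< i<j) j≤k ≡ i
    inject≤-fromℕ< = Fin.toℕ-injective (trans (Fin.toℕ-inject≤ _ j≤k) (Fin.toℕ-fromℕ< i<j))

  i₀ i₁ : Fin j
  i₀ = fromℕ< (ℕ.<-≤-trans (s≤s z≤n) 2≤j)
  i₁ = fromℕ< 2≤j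

  prefix-coprime : Coprime (prefix i₀) (prefix i₁)
  prefix-coprime = P-coprime _ _
    (trans (Fin.toℕ-inject≤ i₀ j≤k) (Fin.toℕ-fromℕ< _))
    (trans (Fin.toℕ-inject≤ i₁ j≤k) (Fin.toℕ-fromℕ< _))

  open Growth (Gen P j) n prefix prefix∈Gen Gen⊆prefix (λ i → toPoly-DegLe (P (inject≤ i j≤k)))
    (LinIndep-inject≤ j≤k P-indep) i₀ i₁ prefix-coprime public

2n+1∸k≡[1+n∸k]+n : ∀ n k → k ≤ suc n → 2 * n + 1 ∸ k ≡ (suc n ∸ k) + n
2n+1∸k≡[1+n∸k]+n n k k≤1+n = begin
  2 * n + 1 ∸ k        ≡⟨ cong (_∸ k) (ℕ.+-comm (2 * n) 1) ⟩
  suc (n + (n + 0)) ∸ k ≡⟨ cong (λ m → suc (n + m) ∸ k) (ℕ.+-identityʳ n) ⟩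
  suc (n + n) ∸ k      ≡⟨ cong (_∸ k) (sym (ℕ.+-suc n n)) ⟩
  n + suc n ∸ k        ≡⟨ ℕ.+-∸-assoc n k≤1+n ⟩
  n + (suc n ∸ k)      ≡⟨ ℕ.+-comm n (suc n ∸ k) ⟩
  (suc n ∸ k) + n      ∎
  where open ≡-Reasoning

2[1+n∸k]+k≡1+[1+n∸k]+n : ∀ n k → k ≤ suc n → 2 * (suc n ∸ k) + k ≡ suc ((suc n ∸ k) + n)
2[1+n∸k]+k≡1+[1+n∸k]+n n k k≤1+n = begin
  2 * e + k        ≡⟨ cong (λ m → e + m + k) (ℕ.+-identityʳ e) ⟩
  e + e + k        ≡⟨ ℕ.+-assoc e e k ⟩
  e + (e + k)      ≡⟨ cong (e +_) (ℕ.m∸n+n≡m k≤1+n) ⟩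
  e + suc n        ≡⟨ ℕ.+-suc e n ⟩
  suc (e + n)      ∎
  where
  open ≡-Reasoning
  e = suc n ∸ k

corollary5p3 : (n k : ℕ) → 2 ≤ n → 2 ≤ k → k ≤ suc n →
    (P : Fin k → Fin (suc n) → ℤ) →
    LinIndep (λ i → toPoly (P i)) →
    (∀ i i′ → toℕ i ≡ 0 → toℕ i′ ≡ 1 → Coprime (toPoly (P i)) (toPoly (P i′))) →
    (∀ j → 2 ≤ j → j ≤ k →
      DimGe (V (2 * n + 1 ∸ k) (Gen P j)) (2 * (suc n ∸ k) + j))
    × (∀ v → DegLe v (2 * n + 1 ∸ k) → V (2 * n + 1 ∸ k) (Gen P k) v)
corollary5p3 n k _ 2≤k k≤1+n P P-indep P-coprime = dimension , spanning
  where
  e = suc n ∸ k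
  N≡e+n = 2n+1∸k≡[1+n∸k]+n n k k≤1+n
  2e+k≡1+e+n = 2[1+n∸k]+k≡1+[1+n∸k]+n n k k≤1+n
  module PrefixOf {j} (2≤j : 2 ≤ j) (j≤k : j ≤ k) = Prefix P P-indep P-coprime 2≤j j≤k

  dimension : ∀ j → 2 ≤ j → j ≤ k → DimGe (V (2 * n + 1 ∸ k) (Gen P j)) (2 * e + j)
  dimension j 2≤j j≤k = subst (λ N → DimGe (V N (Gen P j)) (2 * e + j)) (sym N≡e+n)
    (PrefixOf.V-DimGe 2≤j j≤k e ℕ.≤-refl
      (ℕ.≤-trans (ℕ.+-monoʳ-≤ (2 * e) j≤k) (ℕ.≤-reflexive 2e+k≡1+e+n)))

  spanning : ∀ v → DegLe v (2 * n + 1 ∸ k) → V (2 * n + 1 ∸ k) (Gen P k) v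
  spanning v v≤N = subst (λ N → V N (Gen P k) v) (sym N≡e+n)
    (PrefixOf.V-full 2≤k ℕ.≤-refl e (ℕ.≤-reflexive (sym 2e+k≡1+e+n)) (subst (DegLe v) N≡e+n v≤N))
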